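{- For every bipartite graph $G=(L,R,E)$ with maximum degree $d_{max}$ and degeneracy $\delta(G)$, if $o=(v_{1},\ldots,v_{|L|+|R|})$ is a degeneracy order of $G$, then the total size of the vertex centred subgraphs of $G$ with respect to $o$ is $\mathcal{O}((|L|+|R|)\,\delta(G)\,d_{max})$.
   Context: The core number of a vertex $u$ is the largest $c$ such that some subgraph of $G$ containing $u$ has minimum degree at least $c$; the degeneracy $\delta(G)$ is the maximum core number. A degeneracy order is an ordering $(v_1,\ldots,v_{|L|+|R|})$ of all vertices in which each $v_i$ has minimum degree in the subgraph of $G$ induced by $\{v_i,\ldots,v_{|L|+|R|}\}$. For a vertex $u$, $N_{\le 2}(u,G)$ is the set of vertices at shortest-path distance $1$ or $2$ from $u$ in $G$. Given an ordering $o=(v_1,\ldots,v_{|L|+|R|})$, the $v_i$ centred subgraph is the subgraph of $G$ induced by $\{v_i\}\cup\big(N_{\le 2}(v_i,G)\cap\{v_{i+1},\ldots,v_{|L|+|R|}\}\big)$. The total size is the sum over all $i$ of the number of vertices of the $v_i$ centred subgraph. -}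

module Defs where

open import Data.Nat using (ℕ; zero; suc; _+_; _*_; _≤_; _⊔_)
open import Data.Bool using (Bool; true; false; _∧_; _∨_; not; if_then_else_)
open import Data.Fin using (Fin; _≟_; _≤?_; _<?_)
open import Data.List using (List; allFin; map; foldr)
open import Data.Nat.ListAction using (sum)
open import Data.Bool.ListAction using (any)
open import Data.Fin.Permutation using (Permutation′; _⟨$⟩ʳ_; _⟨$⟩ˡ_)
open import Data.Product using (Σ; _×_; ∃)
open import Relation.Nullary.Decidable using (⌊_⌋)
open import Relation.Binary.PropositionalEquality using (_≡_; _≢_)

record Graph (n : ℕ) : Set where
  field
    adj     : Fin n → Fin n → Bool
    symm    : ∀ u v → adj u v ≡ adj v u
    irrefl  : ∀ u → adj u u ≡ false
open Graph public

-- Bipartite: there is a 2-colouring (side false = L, side true = R) so every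
-- edge goes between L and R.  Then |L| + |R| = n.
IsBipartite : ∀ {n} → Graph n → Set
IsBipartite {n} G =
  Σ (Fin n → Bool) λ side → ∀ u v → adj G u v ≡ true → side u ≢ side v

VSet : ℕ → Set
VSet n = Fin n → Bool

count : ∀ {n} → (Fin n → Bool) → ℕ
count {n} p = sum (map (λ w → if p w then 1 else 0) (allFin n))

degIn : ∀ {n} → Graph n → VSet n → Fin n → ℕ
degIn G S v = count (λ w → S w ∧ adj G v w)

deg : ∀ {n} → Graph n → Fin n → ℕ
deg G v = degIn G (λ _ → true) v

maxDegree : ∀ {n} → Graph n → ℕ
maxDegree {n} G = foldr _⊔_ 0 (map (deg G) (allFin n))

MinDegAtLeast : ∀ {n} → Graph n → VSet n → ℕ → Set
MinDegAtLeast {n} G S c = ∀ v → S v ≡ true → c ≤ degIn G S v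

IsCoreNumber : ∀ {n} → Graph n → Fin n → ℕ → Set
IsCoreNumber {n} G u c =
  (Σ (VSet n) λ S → (S u ≡ true) × MinDegAtLeast G S c)
  × (∀ c′ (S : VSet n) → S u ≡ true → MinDegAtLeast G S c′ → c′ ≤ c)

IsDegeneracy : ∀ {n} → Graph n → ℕ → Set
IsDegeneracy {n} G δ =
  (∃ λ (u : Fin n) → IsCoreNumber G u δ)
  × (∀ (u : Fin n) c → IsCoreNumber G u c → c ≤ δ)

-- An ordering o of the vertices: v_i = o ⟨$⟩ʳ i, and the position of a
-- vertex w is o ⟨$⟩ˡ w.  suffix o i = {v_i, v_{i+1}, ...}.
suffix : ∀ {n} → Permutation′ n → Fin n → VSet n
suffix o i w = ⌊ i ≤? (o ⟨$⟩ˡ w) ⌋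

strictSuffix : ∀ {n} → Permutation′ n → Fin n → VSet n
strictSuffix o i w = ⌊ i <? (o ⟨$⟩ˡ w) ⌋

IsDegeneracyOrder : ∀ {n} → Graph n → Permutation′ n → Set
IsDegeneracyOrder {n} G o =
  ∀ (i : Fin n) (w : Fin n) → suffix o i w ≡ true →
    degIn G (suffix o i) (o ⟨$⟩ʳ i) ≤ degIn G (suffix o i) w

N≤2 : ∀ {n} → Graph n → Fin n → VSet n
N≤2 {n} G u w =
  not ⌊ u ≟ w ⌋ ∧ (adj G u w ∨ any (λ x → adj G u x ∧ adj G x w) (allFin n))

-- number of vertices of the v_i centred subgraph:
-- |{v_i} ∪ (N_{≤2}(v_i) ∩ {v_{i+1}, ...})|
centredSize : ∀ {n} → Graph n → Permutation′ n → Fin n → ℕ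
centredSize G o i =
  suc (count (λ w → N≤2 G (o ⟨$⟩ʳ i) w ∧ strictSuffix o i w))

totalSize : ∀ {n} → Graph n → Permutation′ n → ℕ
totalSize {n} G o = sum (map (centredSize G o) (allFin n))

HasEdge : ∀ {n} → Graph n → Set
HasEdge {n} G = Σ (Fin n) λ u → Σ (Fin n) λ v → adj G u v ≡ true

module Submission where

-- Write v_i for the i-th vertex of the order o, pos(x) for the position of a
-- vertex x, D for the maximum degree.  The argument has three ingredients.
--  (1) Later degrees are small: every vertex x has at most δ neighbours that do
--      not precede it.  Indeed the suffix {v_pos(x), ...} contains x and, o being
--      a degeneracy order, has minimum degree equal to the degree of x in it; so
--      that degree is at most the core number of x, hence at most δ.  (Core
--      numbers exist because all vertex subsets can be searched exhaustively.)
--  (2) Local bound: a vertex w after v_i at distance ≤ 2 from v_i is a later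
--      neighbour of v_i (≤ δ of them) or a neighbour of some neighbour x of v_i
--      (≤ D for each x).  Such x are later neighbours (≤ δ) or earlier neighbours,
--      say b(i) many, so the v_i centred subgraph has ≤ 1 + δ + Dδ + D·b(i) vertices.
--  (3) Double counting: Σ_i b(i) counts the edges by their later endpoint, i.e.
--      equals the sum of the later degrees, which is ≤ nδ by (1).
-- Summing, totalSize ≤ n(1 + δ + Dδ) + Dnδ ≤ 4nδD as δ, D ≥ 1 once G has an edge.

open import Defs
open import Data.Nat using (ℕ; zero; suc; _+_; _*_; _≤_; _⊔_; z≤n; s≤s)
import Data.Nat as ℕ
open import Data.Nat.Properties
  using ( +-mono-≤; +-monoʳ-≤; +-monoˡ-≤; *-monoʳ-≤; ≤-refl; ≤-reflexive; ≤-trans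
        ; m≤m+n; m≤n+m; m≤m⊔n; m≤n⊔m; *-identityʳ; +-assoc; *-comm; *-distribˡ-+; module ≤-Reasoning
        ; *-identityˡ; m≤n⇒m<n∨m≡n; <⇒≤; +-*-semiring)
open import Data.Bool using (Bool; true; false; _∧_; _∨_; not; if_then_else_)
open import Data.Bool.Properties using (∧-comm; ∨-zeroʳ)
import Data.Bool.Properties as Bool
open import Data.Fin using (Fin; zero; suc; _≟_; _≤?_; _<?_)
open import Data.Fin.Properties using (all?; ≤-total)
import Data.Fin.Properties as Fin
open import Data.Fin.Subset.Properties using (anySubset?)
open import Data.Fin.Permutation using (Permutation′; _⟨$⟩ʳ_; _⟨$⟩ˡ_; inverseˡ; inverseʳ)
open import Data.Vec using (lookup; tabulate)
open import Data.Vec.Properties using (lookup∘tabulate)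
open import Data.List using (allFin; map; foldr)
import Data.List as List
open import Data.Nat.ListAction using () renaming (sum to listSum)
open import Data.Bool.ListAction using (any)
open import Data.Product using (Σ; _×_; _,_; proj₂)
open import Data.Sum using (inj₁; inj₂)
open import Data.Empty using (⊥-elim)
open import Relation.Nullary using (Dec; yes; no)
open import Relation.Nullary.Decidable using (⌊_⌋; _→-dec_; _×-dec_; map′; dec-true; isYes≗does)
open import Relation.Binary.PropositionalEquality
open import Function using (_∘_)
open import Data.Nat.Tactic.RingSolver using (solve-∀)
open import Algebra.Properties.Semiring.Sum +-*-semiring
  using (sum-cong-≗; ∑-distrib-+; ∑-comm; sum-permute; *-distribˡ-sum; sum-replicate-zero)
  renaming (sum to ∑)

𝟙 : Bool → ℕ
𝟙 b = if b then 1 else 0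

⌊⌋-true : ∀ {A : Set} (a? : Dec A) → A → ⌊ a? ⌋ ≡ true
⌊⌋-true a? a = trans (isYes≗does a?) (dec-true a? a)

listSum-tabulate : ∀ {A : Set} {n} (f : A → ℕ) (g : Fin n → A) →
                   listSum (map f (List.tabulate g)) ≡ ∑ (f ∘ g)
listSum-tabulate {n = zero}  f g = refl
listSum-tabulate {n = suc n} f g = cong (f (g zero) +_) (listSum-tabulate f (g ∘ suc))

count≡∑ : ∀ {n} (p : Fin n → Bool) → count p ≡ ∑ (𝟙 ∘ p)
count≡∑ p = listSum-tabulate (λ w → 𝟙 (p w)) (λ w → w)

∑-mono : ∀ {n} {f g : Fin n → ℕ} → (∀ i → f i ≤ g i) → ∑ f ≤ ∑ g
∑-mono {zero}  f≤g = z≤n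
∑-mono {suc n} f≤g = +-mono-≤ (f≤g zero) (∑-mono (f≤g ∘ suc))

∑-bounded : ∀ {n} c (f : Fin n → ℕ) → (∀ i → f i ≤ c) → ∑ f ≤ n * c
∑-bounded {zero}  c f f≤c = z≤n
∑-bounded {suc n} c f f≤c = +-mono-≤ (f≤c zero) (∑-bounded c (f ∘ suc) (f≤c ∘ suc))

term≤∑ : ∀ {n} (f : Fin n → ℕ) (k : Fin n) → f k ≤ ∑ f
term≤∑ f zero    = m≤m+n _ _
term≤∑ f (suc k) = ≤-trans (term≤∑ (f ∘ suc) k) (m≤n+m _ _)

∑-guard : ∀ {n} a (p : Fin n → Bool) → ∑ (λ w → 𝟙 (a ∧ p w)) ≡ 𝟙 a * count p
∑-guard     true  p = sym (trans (*-identityˡ (count p)) (count≡∑ p))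
∑-guard {n} false p = sum-replicate-zero n

𝟙-or≤∑ : ∀ {A : Set} {m} (f : A → Bool) (g : Fin m → A) →
         𝟙 (any f (List.tabulate g)) ≤ ∑ (𝟙 ∘ f ∘ g)
𝟙-or≤∑ {m = zero}  f g = z≤n
𝟙-or≤∑ {m = suc m} f g with f (g zero)
... | true  = s≤s z≤n
... | false = 𝟙-or≤∑ f (g ∘ suc)

degIn-cong : ∀ {n} (G : Graph n) {S S′ : VSet n} → (∀ w → S w ≡ S′ w) →
             ∀ v → degIn G S v ≡ degIn G S′ v
degIn-cong G {S} {S′} S≗S′ v = begin
  degIn G S v                      ≡⟨ count≡∑ (λ w → S w ∧ adj G v w) ⟩
  ∑ (λ w → 𝟙 (S w ∧ adj G v w))    ≡⟨ sum-cong-≗ (λ w → cong (λ b → 𝟙 (b ∧ adj G v w)) (S≗S′ w)) ⟩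
  ∑ (λ w → 𝟙 (S′ w ∧ adj G v w))   ≡⟨ count≡∑ (λ w → S′ w ∧ adj G v w) ⟨
  degIn G S′ v                     ∎
  where open ≡-Reasoning

count≤n : ∀ {n} (p : Fin n → Bool) → count p ≤ n
count≤n {n} p = begin
  count p        ≡⟨ count≡∑ p ⟩
  ∑ (𝟙 ∘ p)      ≤⟨ ∑-bounded 1 (𝟙 ∘ p) (λ w → 𝟙≤1 (p w)) ⟩
  n * 1          ≡⟨ *-identityʳ n ⟩
  n              ∎
  where
  open ≤-Reasoning
  𝟙≤1 : ∀ b → 𝟙 b ≤ 1
  𝟙≤1 true  = s≤s z≤n
  𝟙≤1 false = z≤n

nbr⇒1≤degIn : ∀ {n} (G : Graph n) (S : VSet n) {x y} →
              S y ≡ true → adj G x y ≡ true → 1 ≤ degIn G S x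
nbr⇒1≤degIn G S {x} {y} Sy xy rewrite count≡∑ (λ z → S z ∧ adj G x z) =
  subst (λ b → 𝟙 b ≤ ∑ (λ z → 𝟙 (S z ∧ adj G x z))) (cong₂ _∧_ Sy xy)
        (term≤∑ (λ z → 𝟙 (S z ∧ adj G x z)) y)

deg≤maxDegree : ∀ {n} (G : Graph n) x → deg G x ≤ maxDegree G
deg≤maxDegree {n} G = below-max (λ x → x)
  where
  below-max : ∀ {m} (g : Fin m → Fin n) k →
              deg G (g k) ≤ foldr _⊔_ 0 (map (deg G) (List.tabulate g))
  below-max g zero    = m≤m⊔n _ _
  below-max g (suc k) = ≤-trans (below-max (g ∘ suc) k) (m≤n⊔m _ _)

∃VSet? : ∀ {n} (P : VSet n → Set) → (∀ S → Dec (P S)) →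
         (∀ {S S′} → (∀ w → S w ≡ S′ w) → P S → P S′) → Dec (Σ (VSet n) P)
∃VSet? P P? P-ext = map′
  (λ (s , Ps) → lookup s , Ps)
  (λ (S , PS) → tabulate S , P-ext (λ w → sym (lookup∘tabulate S w)) PS)
  (anySubset? {P = P ∘ lookup} (P? ∘ lookup))

greatest : (P : ℕ → Set) → (∀ c → Dec (P c)) → P 0 → ∀ b → (∀ c → P c → c ≤ b) →
           Σ ℕ λ c → P c × (∀ c′ → P c′ → c′ ≤ c)
greatest P P? P0 b bounded =
  let c , Pc , max = greatest-below b in c , Pc , λ c′ Pc′ → max c′ (bounded c′ Pc′) Pc′
  where
  greatest-below : ∀ k → Σ ℕ λ c → P c × (∀ c′ → c′ ≤ k → P c′ → c′ ≤ c)
  greatest-below zero = 0 , P0 , λ { _ z≤n _ → z≤n }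
  greatest-below (suc k) with P? (suc k) | greatest-below k
  ... | yes P[1+k] | _           = suc k , P[1+k] , λ _ c′≤1+k _ → c′≤1+k
  ... | no ¬P[1+k] | c , Pc , max = c , Pc , max′
    where
    max′ : ∀ c′ → c′ ≤ suc k → P c′ → c′ ≤ c
    max′ c′ c′≤1+k Pc′ with m≤n⇒m<n∨m≡n c′≤1+k
    ... | inj₁ (s≤s c′≤k) = max c′ c′≤k Pc′
    ... | inj₂ refl       = ⊥-elim (¬P[1+k] Pc′)

module _ {n} (G : Graph n) where

  InCore : Fin n → ℕ → Set
  InCore u c = Σ (VSet n) λ S → (S u ≡ true) × MinDegAtLeast G S c

  inCore? : ∀ u c → Dec (InCore u c)
  inCore? u c = ∃VSet? _
    (λ S → (S u Bool.≟ true) ×-dec all? (λ v → (S v Bool.≟ true) →-dec (c ℕ.≤? degIn G S v)))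
    (λ S≗S′ (Su , md) → trans (sym (S≗S′ u)) Su ,
       λ v S′v → subst (c ≤_) (degIn-cong G S≗S′ v) (md v (trans (S≗S′ v) S′v)))

  coreNumber : ∀ u → Σ ℕ (IsCoreNumber G u)
  coreNumber u =
    let c , inCore , max = greatest (InCore u) (inCore? u) whole n bounded
    in c , inCore , λ c′ S Su md → max c′ (S , Su , md)
    where
    whole : InCore u 0
    whole = (λ _ → true) , refl , (λ _ _ → z≤n)
    bounded : ∀ c → InCore u c → c ≤ n
    bounded c (S , Su , md) = ≤-trans (md u Su) (count≤n _)

  minDeg≤degeneracy : ∀ {δ} → IsDegeneracy G δ → ∀ {u c} (S : VSet n) →
                      S u ≡ true → MinDegAtLeast G S c → c ≤ δ
  minDeg≤degeneracy (_ , core≤δ) {u} {c} S Su md with coreNumber u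
  ... | cᵤ , isCore = ≤-trans (proj₂ isCore c S Su md) (core≤δ u cᵤ isCore)

-- An edge uw makes {u, w} a vertex set of minimum degree 1, so δ ≥ 1 and D ≥ 1.
degeneracy≥1 : ∀ {n} (G : Graph n) → HasEdge G → ∀ {δ} → IsDegeneracy G δ → 1 ≤ δ
degeneracy≥1 {n} G (u , w , uw) isDeg = minDeg≤degeneracy G isDeg endpoints u∈ minDeg1
  where
  endpoints : VSet n
  endpoints y = ⌊ u ≟ y ⌋ ∨ ⌊ w ≟ y ⌋
  u∈ : endpoints u ≡ true
  u∈ = cong (_∨ ⌊ w ≟ u ⌋) (⌊⌋-true (u ≟ u) refl)
  w∈ : endpoints w ≡ true
  w∈ = trans (cong (⌊ u ≟ w ⌋ ∨_) (⌊⌋-true (w ≟ w) refl)) (∨-zeroʳ _)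
  minDeg1 : MinDegAtLeast G endpoints 1
  minDeg1 y y∈ with u ≟ y | w ≟ y
  ... | yes refl | _        = nbr⇒1≤degIn G endpoints w∈ uw
  ... | no _     | yes refl = nbr⇒1≤degIn G endpoints u∈ (trans (symm G w u) uw)
  ... | no _     | no _     with () ← y∈

maxDegree≥1 : ∀ {n} (G : Graph n) → HasEdge G → 1 ≤ maxDegree G
maxDegree≥1 G (u , w , uw) = ≤-trans (nbr⇒1≤degIn G (λ _ → true) refl uw) (deg≤maxDegree G u)

strict⇒weak : ∀ {n} (i j : Fin n) → ⌊ i <? j ⌋ ≡ true → ⌊ i ≤? j ⌋ ≡ true
strict⇒weak i j i<j with i <? j
strict⇒weak i j _  | yes i<j = ⌊⌋-true (i ≤? j) (<⇒≤ i<j)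
strict⇒weak i j () | no _

𝟙-split-by-order : ∀ {n} b (i j : Fin n) → 𝟙 b ≤ 𝟙 (⌊ i ≤? j ⌋ ∧ b) + 𝟙 (b ∧ ⌊ j ≤? i ⌋)
𝟙-split-by-order false i j = z≤n
𝟙-split-by-order true  i j with ≤-total i j
... | inj₁ i≤j rewrite ⌊⌋-true (i ≤? j) i≤j = s≤s z≤n
... | inj₂ j≤i rewrite ⌊⌋-true (j ≤? i) j≤i = m≤n+m 1 _

-- A vertex other than the centre that is adjacent (b) or two-step reachable (c),
-- and later (s, implying s′), is a later neighbour or two-step reachable.
𝟙-N≤2-split : ∀ a b c {s s′} → (s ≡ true → s′ ≡ true) →
              𝟙 ((not a ∧ (b ∨ c)) ∧ s) ≤ 𝟙 (s′ ∧ b) + 𝟙 c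
𝟙-N≤2-split true  b     c     {s}     s⇒s′ = z≤n
𝟙-N≤2-split false true  c     {false} s⇒s′ = z≤n
𝟙-N≤2-split false false true  {false} s⇒s′ = z≤n
𝟙-N≤2-split false false false {false} s⇒s′ = z≤n
𝟙-N≤2-split false true  c     {true}  s⇒s′ rewrite s⇒s′ refl = s≤s z≤n
𝟙-N≤2-split false false true  {true}  s⇒s′ = m≤n+m 1 _
𝟙-N≤2-split false false false {true}  s⇒s′ = z≤n

module AlongDegeneracyOrder {n} (G : Graph n) {δ} (isDeg : IsDegeneracy G δ)
                            (o : Permutation′ n) (isOrd : IsDegeneracyOrder G o) where

  v : Fin n → Fin n
  v i = o ⟨$⟩ʳ i

  pos : Fin n → Fin n
  pos x = o ⟨$⟩ˡ x

  D : ℕ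
  D = maxDegree G

  laterDeg : Fin n → ℕ
  laterDeg x = degIn G (suffix o (pos x)) x

  -- (1) The suffix starting at x has minimum degree laterDeg x and contains x.
  laterDeg≤δ : ∀ x → laterDeg x ≤ δ
  laterDeg≤δ x = minDeg≤degeneracy G isDeg (suffix o (pos x)) x∈suffix minDeg
    where
    x∈suffix : suffix o (pos x) x ≡ true
    x∈suffix = ⌊⌋-true (pos x ≤? pos x) Fin.≤-refl
    minDeg : MinDegAtLeast G (suffix o (pos x)) (laterDeg x)
    minDeg w w∈suffix = subst (λ y → degIn G (suffix o (pos x)) y ≤ degIn G (suffix o (pos x)) w)
                              (inverseʳ o) (isOrd (pos x) w w∈suffix)

  laterAdj earlierAdj : Fin n → Fin n → Bool
  laterAdj   i w = ⌊ i ≤? pos w ⌋ ∧ adj G (v i) w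
  earlierAdj i x = adj G (v i) x ∧ ⌊ pos x ≤? i ⌋

  earlierDeg : Fin n → ℕ
  earlierDeg i = count (earlierAdj i)

  laterDegAt≤δ : ∀ i → ∑ (𝟙 ∘ laterAdj i) ≤ δ
  laterDegAt≤δ i = begin
    ∑ (𝟙 ∘ laterAdj i)              ≡⟨ count≡∑ (laterAdj i) ⟨
    degIn G (suffix o i) (v i)      ≡⟨ cong (λ j → degIn G (suffix o j) (v i)) (inverseˡ o) ⟨
    laterDeg (v i)                  ≤⟨ laterDeg≤δ (v i) ⟩
    δ                               ∎
    where open ≤-Reasoning

  twoPath : Fin n → Fin n → Fin n → Bool
  twoPath i x w = adj G (v i) x ∧ adj G x w

  centredMember≤ : ∀ i w → 𝟙 (N≤2 G (v i) w ∧ strictSuffix o i w)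
                           ≤ 𝟙 (laterAdj i w) + ∑ (λ x → 𝟙 (twoPath i x w))
  centredMember≤ i w =
    ≤-trans (𝟙-N≤2-split ⌊ v i ≟ w ⌋ (adj G (v i) w) (any (λ x → twoPath i x w) (allFin n))
                         (strict⇒weak i (pos w)))
            (+-monoʳ-≤ (𝟙 (laterAdj i w)) (𝟙-or≤∑ (λ x → twoPath i x w) (λ x → x)))

  -- Each middle vertex x has at most D continuations; split x by its position.
  twoPaths≤ : ∀ i x → ∑ (λ w → 𝟙 (twoPath i x w)) ≤ D * 𝟙 (laterAdj i x) + D * 𝟙 (earlierAdj i x)
  twoPaths≤ i x = begin
    ∑ (λ w → 𝟙 (twoPath i x w))   ≡⟨ ∑-guard (adj G (v i) x) (adj G x) ⟩
    𝟙 (adj G (v i) x) * deg G x   ≤⟨ *-monoʳ-≤ (𝟙 (adj G (v i) x)) (deg≤maxDegree G x) ⟩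
    𝟙 (adj G (v i) x) * D         ≡⟨ *-comm (𝟙 (adj G (v i) x)) D ⟩
    D * 𝟙 (adj G (v i) x)         ≤⟨ *-monoʳ-≤ D (𝟙-split-by-order (adj G (v i) x) i (pos x)) ⟩
    D * (𝟙 (laterAdj i x) + 𝟙 (earlierAdj i x))
                                  ≡⟨ *-distribˡ-+ D (𝟙 (laterAdj i x)) (𝟙 (earlierAdj i x)) ⟩
    D * 𝟙 (laterAdj i x) + D * 𝟙 (earlierAdj i x) ∎
    where open ≤-Reasoning

  centredSize≤ : ∀ i → centredSize G o i ≤ suc (δ + D * δ) + D * earlierDeg i
  centredSize≤ i = s≤s (begin
    count (λ w → N≤2 G (v i) w ∧ strictSuffix o i w)
      ≡⟨ count≡∑ (λ w → N≤2 G (v i) w ∧ strictSuffix o i w) ⟩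
    ∑ (λ w → 𝟙 (N≤2 G (v i) w ∧ strictSuffix o i w))
      ≤⟨ ∑-mono (centredMember≤ i) ⟩
    ∑ (λ w → 𝟙 (laterAdj i w) + ∑ (λ x → 𝟙 (twoPath i x w)))
      ≡⟨ ∑-distrib-+ (𝟙 ∘ laterAdj i) (λ w → ∑ (λ x → 𝟙 (twoPath i x w))) ⟩
    ∑ (𝟙 ∘ laterAdj i) + ∑ (λ w → ∑ (λ x → 𝟙 (twoPath i x w)))
      ≡⟨ cong (∑ (𝟙 ∘ laterAdj i) +_) (∑-comm (λ x w → 𝟙 (twoPath i x w))) ⟨
    ∑ (𝟙 ∘ laterAdj i) + ∑ (λ x → ∑ (λ w → 𝟙 (twoPath i x w)))
      ≤⟨ +-mono-≤ (laterDegAt≤δ i) (∑-mono (twoPaths≤ i)) ⟩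
    δ + ∑ (λ x → D * 𝟙 (laterAdj i x) + D * 𝟙 (earlierAdj i x))
      ≡⟨ cong (δ +_) (∑-distrib-+ (λ x → D * 𝟙 (laterAdj i x)) (λ x → D * 𝟙 (earlierAdj i x))) ⟩
    δ + (∑ (λ x → D * 𝟙 (laterAdj i x)) + ∑ (λ x → D * 𝟙 (earlierAdj i x)))
      ≡⟨ cong (δ +_) (cong₂ _+_ (*-distribˡ-sum D (𝟙 ∘ laterAdj i)) (*-distribˡ-sum D (𝟙 ∘ earlierAdj i))) ⟨
    δ + (D * ∑ (𝟙 ∘ laterAdj i) + D * ∑ (𝟙 ∘ earlierAdj i))
      ≤⟨ +-monoʳ-≤ δ (+-monoˡ-≤ (D * ∑ (𝟙 ∘ earlierAdj i)) (*-monoʳ-≤ D (laterDegAt≤δ i))) ⟩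
    δ + (D * δ + D * ∑ (𝟙 ∘ earlierAdj i))
      ≡⟨ cong (λ b → δ + (D * δ + D * b)) (count≡∑ (earlierAdj i)) ⟨
    δ + (D * δ + D * earlierDeg i)
      ≡⟨ +-assoc δ (D * δ) (D * earlierDeg i) ⟨
    δ + D * δ + D * earlierDeg i ∎)
    where open ≤-Reasoning

  -- Read column-wise, the earlier-neighbour relation lists the later neighbours of x.
  column : ∀ x → ∑ (λ i → 𝟙 (earlierAdj i x)) ≡ laterDeg x
  column x = begin
    ∑ (λ i → 𝟙 (adj G (v i) x ∧ ⌊ pos x ≤? i ⌋))
      ≡⟨ sum-cong-≗ (λ i → cong (λ j → 𝟙 (adj G (v i) x ∧ ⌊ pos x ≤? j ⌋)) (inverseˡ o)) ⟨
    ∑ (f ∘ v)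
      ≡⟨ sum-permute f o ⟨
    ∑ f
      ≡⟨ sum-cong-≗ (λ w → cong 𝟙 (trans (cong (_∧ ⌊ pos x ≤? pos w ⌋) (symm G w x))
                                          (∧-comm (adj G x w) ⌊ pos x ≤? pos w ⌋))) ⟩
    ∑ (λ w → 𝟙 (⌊ pos x ≤? pos w ⌋ ∧ adj G x w))
      ≡⟨ count≡∑ (λ w → ⌊ pos x ≤? pos w ⌋ ∧ adj G x w) ⟨
    laterDeg x ∎
    where
    open ≡-Reasoning
    f : Fin n → ℕ
    f w = 𝟙 (adj G w x ∧ ⌊ pos x ≤? pos w ⌋)

  ∑earlierDeg≤ : ∑ earlierDeg ≤ n * δ
  ∑earlierDeg≤ = begin
    ∑ earlierDeg                               ≡⟨ sum-cong-≗ (λ i → count≡∑ (earlierAdj i)) ⟩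
    ∑ (λ i → ∑ (λ x → 𝟙 (earlierAdj i x)))     ≡⟨ ∑-comm (λ i x → 𝟙 (earlierAdj i x)) ⟩
    ∑ (λ x → ∑ (λ i → 𝟙 (earlierAdj i x)))     ≡⟨ sum-cong-≗ column ⟩
    ∑ laterDeg                                 ≤⟨ ∑-bounded δ laterDeg laterDeg≤δ ⟩
    n * δ                                      ∎
    where open ≤-Reasoning

  totalSize≤ : totalSize G o ≤ n * suc (δ + D * δ) + D * (n * δ)
  totalSize≤ = begin
    totalSize G o                        ≡⟨ listSum-tabulate (centredSize G o) (λ i → i) ⟩
    ∑ (centredSize G o)                  ≤⟨ ∑-mono centredSize≤ ⟩
    ∑ (λ i → c i + D * earlierDeg i)     ≡⟨ ∑-distrib-+ c (λ i → D * earlierDeg i) ⟩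
    ∑ c + ∑ (λ i → D * earlierDeg i)     ≡⟨ cong (∑ c +_) (*-distribˡ-sum D earlierDeg) ⟨
    ∑ c + D * ∑ earlierDeg               ≤⟨ +-mono-≤ (∑-bounded (suc (δ + D * δ)) c (λ _ → ≤-refl))
                                                     (*-monoʳ-≤ D ∑earlierDeg≤) ⟩
    n * suc (δ + D * δ) + D * (n * δ)    ∎
    where
    open ≤-Reasoning
    c : Fin n → ℕ
    c _ = suc (δ + D * δ)

-- With δ, D ≥ 1 every term of n(1 + δ + Dδ) + Dnδ is at most nδD.
collect : ∀ n δ D → 1 ≤ δ → 1 ≤ D → n * suc (δ + D * δ) + D * (n * δ) ≤ 4 * (n * δ * D)
collect n δ D 1≤δ 1≤D = subst₂ _≤_ (sym (expand n δ D)) (sym (four-times (n * δ * D)))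
  (+-mono-≤ n≤nδD (+-mono-≤ nδ≤nδD ≤-refl))
  where
  expand : ∀ n δ D → n * suc (δ + D * δ) + D * (n * δ) ≡ n + (n * δ + (n * δ * D + n * δ * D))
  expand = solve-∀
  four-times : ∀ X → 4 * X ≡ X + (X + (X + X))
  four-times = solve-∀
  nδ≤nδD : n * δ ≤ n * δ * D
  nδ≤nδD = ≤-trans (≤-reflexive (sym (*-identityʳ (n * δ)))) (*-monoʳ-≤ (n * δ) 1≤D)
  n≤nδD : n ≤ n * δ * D
  n≤nδD = ≤-trans (≤-reflexive (sym (*-identityʳ n))) (≤-trans (*-monoʳ-≤ n 1≤δ) nδ≤nδD)

lemma7 : Σ ℕ λ C →
    ∀ (n : ℕ) (G : Graph n) → IsBipartite G → HasEdge G →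
    ∀ (δ : ℕ) → IsDegeneracy G δ →
    ∀ (o : Permutation′ n) → IsDegeneracyOrder G o →
    totalSize G o ≤ C * (n * δ * maxDegree G)
lemma7 = 4 , λ n G _ hasEdge δ isDeg o isOrd →
  ≤-trans (AlongDegeneracyOrder.totalSize≤ G isDeg o isOrd)
          (collect n δ (maxDegree G) (degeneracy≥1 G hasEdge isDeg) (maxDegree≥1 G hasEdge))
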